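{- Let $A,s$ be positive integers, $(\alpha,\beta)\in(\mathbb{Z}/s\mathbb{Z})^2$, and let $\ell=\mathbb{Z}v_1+\mathbb{Z}v_2=[A,b,a]$ be a binary $\mathbb{Z}$-lattice with $(a,b)\equiv(\alpha,\beta)\pmod s$ and $Aa-b^2>0$. Let $L$ be a $\mathbb{Z}$-lattice and $w\in R(A,L)$ with $L\prec_{A,(\alpha,\beta),s}w$. If $\ell$ is represented by $L$, then there is a representation $\sigma:\ell\to L$ with $\sigma(v_1)=w$.
   Context: All $\mathbb{Z}$-lattices are positive definite and integral, with bilinear form $B$ and $Q(v)=B(v,v)$; $L$ lies on the quadratic space $V=\mathbb{Q}L$ with orthogonal group $O(V)$. $[A,b,a]$ denotes $\mathbb{Z}v_1+\mathbb{Z}v_2$ with $Q(v_1)=A$, $B(v_1,v_2)=b$, $Q(v_2)=a$; a representation is a linear map preserving $B$. $R(A,L)=\{v\in L:Q(v)=A\}$. For $v\in R(A,L)$: $R_v(L,\alpha,\beta,s)=\{u\in L/sL: Q(u)\equiv\alpha,\ B(u,v)\equiv\beta\pmod s\}$; for $v,w\in R(A,L)$: $R_{v,w}(L,s)=\{\tau\in O(V):\tau(sL)\subset L,\ \tau(v)=w\}$. A coset $u\in R_v(L,\alpha,\beta,s)$ is good with respect to $w$ if there is $\tau\in R_{v,w}(L,s)$ with $\tau(\tilde u)\in L$ for every $\tilde u\in L$ with $\tilde u\equiv u\pmod{sL}$; the set of such cosets is $R^w_v(L,\alpha,\beta,s)$. One writes $L\prec_{A,(\alpha,\beta),s}w$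 if $R_v(L,\alpha,\beta,s)=R^w_v(L,\alpha,\beta,s)$ for every $v\in R(A,L)$. -}

module Defs where

open import Data.Nat as ℕ using (ℕ; zero; suc)
open import Data.Fin using (Fin; zero; suc)
open import Data.Integer as ℤ using (ℤ; +_)
open import Data.Integer.Divisibility using () renaming (_∣_ to _∣ℤ_)
open import Data.Rational as ℚ using (ℚ)
open import Data.Product using (Σ; _×_)
open import Relation.Binary.PropositionalEquality using (_≡_)
open import Relation.Nullary using (¬_)

-- A positive definite integral ℤ-lattice of rank n is modelled (up to
-- isometry) as ℤⁿ with an integral symmetric Gram matrix G.
Gram : ℕ → Set
Gram n = Fin n → Fin n → ℤ

Vecℤ : ℕ → Set
Vecℤ n = Fin n → ℤ

Vecℚ : ℕ → Set
Vecℚ n = Fin n → ℚ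

∑ℤ : ∀ {n} → (Fin n → ℤ) → ℤ
∑ℤ {zero} f = + 0
∑ℤ {suc n} f = f zero ℤ.+ ∑ℤ (λ i → f (suc i))

∑ℚ : ∀ {n} → (Fin n → ℚ) → ℚ
∑ℚ {zero} f = ℚ.0ℚ
∑ℚ {suc n} f = f zero ℚ.+ ∑ℚ (λ i → f (suc i))

IsSymmetric : ∀ {n} → Gram n → Set
IsSymmetric G = ∀ i j → G i j ≡ G j i

B : ∀ {n} → Gram n → Vecℤ n → Vecℤ n → ℤ
B G x y = ∑ℤ (λ i → ∑ℤ (λ j → x i ℤ.* G i j ℤ.* y j))

Q : ∀ {n} → Gram n → Vecℤ n → ℤ
Q G x = B G x x

IsPosDef : ∀ {n} → Gram n → Set
IsPosDef G = ∀ x → ¬ (∀ i → x i ≡ + 0) → + 0 ℤ.< Q G x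

binGram : ℤ → ℤ → ℤ → Gram 2
binGram A b a zero zero = A
binGram A b a zero (suc zero) = b
binGram A b a (suc zero) zero = b
binGram A b a (suc zero) (suc zero) = a

_≡_[mod_] : ℤ → ℤ → ℕ → Set
x ≡ y [mod s ] = (+ s) ∣ℤ (x ℤ.- y)

toℚ : ℤ → ℚ
toℚ z = z ℚ./ 1

embed : ∀ {n} → Vecℤ n → Vecℚ n
embed x i = toℚ (x i)

Bℚ : ∀ {n} → Gram n → Vecℚ n → Vecℚ n → ℚ
Bℚ G x y = ∑ℚ (λ i → ∑ℚ (λ j → x i ℚ.* toℚ (G i j) ℚ.* y j))

Matℚ : ℕ → Set
Matℚ n = Fin n → Fin n → ℚ

act : ∀ {n} → Matℚ n → Vecℚ n → Vecℚ n
act T x i = ∑ℚ (λ j → T i j ℚ.* x j)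

InO : ∀ {n} → Gram n → Matℚ n → Set
InO G T = ∀ x y → Bℚ G (act T x) (act T y) ≡ Bℚ G x y

InL : ∀ {n} → Vecℚ n → Set
InL {n} v = Σ (Vecℤ n) (λ z → ∀ i → toℚ (z i) ≡ v i)

scale : ∀ {n} → ℕ → Vecℤ n → Vecℤ n
scale s x i = + s ℤ.* x i

InRvw : ∀ {n} → Gram n → ℕ → Vecℤ n → Vecℤ n → Matℚ n → Set
InRvw G s v w T =
  InO G T
  × (∀ x → InL (act T (embed (scale s x))))
  × (∀ i → act T (embed v) i ≡ embed w i)

-- the coset u + sL lies in R_v(L,α,β,s)   (well defined on cosets)
InRv : ∀ {n} → Gram n → ℤ → ℤ → ℕ → Vecℤ n → Vecℤ n → Set
InRv G α β s v u = (Q G u ≡ α [mod s ]) × (B G u v ≡ β [mod s ])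

_≡ᵥ_[modL_] : ∀ {n} → Vecℤ n → Vecℤ n → ℕ → Set
ũ ≡ᵥ u [modL s ] = ∀ i → ũ i ≡ u i [mod s ]

IsGood : ∀ {n} → Gram n → ℕ → Vecℤ n → Vecℤ n → Vecℤ n → Set
IsGood {n} G s v w u =
  Σ (Matℚ n) (λ T → InRvw G s v w T
    × (∀ ũ → ũ ≡ᵥ u [modL s ] → InL (act T (embed ũ))))

InRvʷ : ∀ {n} → Gram n → ℤ → ℤ → ℕ → Vecℤ n → Vecℤ n → Vecℤ n → Set
InRvʷ G α β s v w u = InRv G α β s v u × IsGood G s v w u

-- L ≺_{A,(α,β),s} w : R_v(L,α,β,s) = R^w_v(L,α,β,s) for all v ∈ R(A,L)
-- (set equality of sets of cosets, stated as equivalence of membership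
--  predicates on coset representatives u)
Prec : ∀ {n} → Gram n → ℤ → ℤ → ℤ → ℕ → Vecℤ n → Set
Prec G A α β s w =
  ∀ v → Q G v ≡ A → ∀ u →
    (InRv G α β s v u → InRvʷ G α β s v w u) × (InRvʷ G α β s v w u → InRv G α β s v u)

-- representations σ : ℓ → L (ℓ of rank m with Gram H), given by the
-- images of the basis: σ i j = i-th coordinate of σ(v_j)
Matℤ : ℕ → ℕ → Set
Matℤ n m = Fin n → Fin m → ℤ

apply : ∀ {n m} → Matℤ n m → Vecℤ m → Vecℤ n
apply σ x i = ∑ℤ (λ j → σ i j ℤ.* x j)

IsRepresentation : ∀ {m n} → Gram m → Gram n → Matℤ n m → Set
IsRepresentation H G σ = ∀ x y → B G (apply σ x) (apply σ y) ≡ B H x y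

Represented : ∀ {m n} → Gram m → Gram n → Set
Represented {m} {n} H G = Σ (Matℤ n m) (IsRepresentation H G)

-- The given representation σ₀ sends v₁ to some v ∈ R(A,L), and the coset of
-- u = σ₀(v₂) lies in R_v(L,α,β,s) because Q(u) = a ≡ α and B(u,v) = b ≡ β.
-- Since L ≺ w, that coset is good: some isometry τ of V with τ(v) = w maps u
-- into L. Replacing σ₀ by τ ∘ σ₀ keeps all inner products and sends v₁ to w.
module Submission where

open import Defs
open import Data.Nat as ℕ using (ℕ)
open import Data.Fin using (Fin; zero; suc)
open import Data.Integer as ℤ using (ℤ; +_)
open import Data.Product using (Σ; _×_; _,_; proj₁; proj₂)
open import Relation.Binary.PropositionalEquality
  using (_≡_; refl; sym; trans; cong; cong₂; subst; module ≡-Reasoning)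
import Data.Integer.Properties as ℤP
import Data.Nat.Divisibility as ℕD
import Data.Rational as ℚ
import Data.Rational.Properties as ℚP
import Data.Rational.Unnormalised as ℚᵘ
import Data.Rational.Unnormalised.Properties as ℚᵘP
open import Data.Integer.Tactic.RingSolver using (solve-∀)
import Algebra.Properties.Semiring.Sum ℤP.+-*-semiring as Sum

-- For a variable length, ∑ℤ and the library's sum do not reduce to a common
-- form, so the library lemmas are transported along this equation.
∑ℤ≡sum : ∀ {n} (f : Fin n → ℤ) → ∑ℤ f ≡ Sum.sum f
∑ℤ≡sum {ℕ.zero} f = refl
∑ℤ≡sum {ℕ.suc n} f = cong (ℤ._+_ (f zero)) (∑ℤ≡sum (λ i → f (suc i)))

∑-cong : ∀ {n} {f g : Fin n → ℤ} → (∀ i → f i ≡ g i) → ∑ℤ f ≡ ∑ℤ g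
∑-cong {ℕ.zero} f≗g = refl
∑-cong {ℕ.suc n} f≗g = cong₂ ℤ._+_ (f≗g zero) (∑-cong (λ i → f≗g (suc i)))

*-distribˡ-∑ : ∀ {n} c (f : Fin n → ℤ) → c ℤ.* ∑ℤ f ≡ ∑ℤ (λ i → c ℤ.* f i)
*-distribˡ-∑ c f = trans (cong (c ℤ.*_) (∑ℤ≡sum f))
  (trans (Sum.*-distribˡ-sum c f) (sym (∑ℤ≡sum (λ i → c ℤ.* f i))))

*-distribʳ-∑ : ∀ {n} c (f : Fin n → ℤ) → ∑ℤ f ℤ.* c ≡ ∑ℤ (λ i → f i ℤ.* c)
*-distribʳ-∑ c f = trans (cong (ℤ._* c) (∑ℤ≡sum f))
  (trans (Sum.*-distribʳ-sum c f) (sym (∑ℤ≡sum (λ i → f i ℤ.* c))))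

∑-comm : ∀ {m n} (f : Fin m → Fin n → ℤ) →
  ∑ℤ (λ i → ∑ℤ (λ j → f i j)) ≡ ∑ℤ (λ j → ∑ℤ (λ i → f i j))
∑-comm f = begin
  ∑ℤ (λ i → ∑ℤ (f i))                   ≡⟨ ∑∑≡sum-sum f ⟩
  Sum.sum (λ i → Sum.sum (f i))         ≡⟨ Sum.∑-comm f ⟩
  Sum.sum (λ j → Sum.sum (λ i → f i j)) ≡⟨ ∑∑≡sum-sum (λ j i → f i j) ⟨
  ∑ℤ (λ j → ∑ℤ (λ i → f i j))           ∎
  where
  open ≡-Reasoning
  ∑∑≡sum-sum : ∀ {m n} (g : Fin m → Fin n → ℤ) → ∑ℤ (λ i → ∑ℤ (g i)) ≡ Sum.sum (λ i → Sum.sum (g i))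
  ∑∑≡sum-sum g = trans (∑ℤ≡sum (λ i → ∑ℤ (g i))) (Sum.sum-cong-≗ (λ i → ∑ℤ≡sum (g i)))

∑²-comm : ∀ {m n} (F : Fin n → Fin n → Fin m → Fin m → ℤ) →
  ∑ℤ (λ i → ∑ℤ (λ j → ∑ℤ (λ a → ∑ℤ (λ b → F i j a b)))) ≡
  ∑ℤ (λ a → ∑ℤ (λ b → ∑ℤ (λ i → ∑ℤ (λ j → F i j a b))))
∑²-comm F = begin
  ∑ℤ (λ i → ∑ℤ (λ j → ∑ℤ (λ a → ∑ℤ (λ b → F i j a b))))
    ≡⟨ ∑-cong (λ i → ∑-comm (λ j a → ∑ℤ (F i j a))) ⟩
  ∑ℤ (λ i → ∑ℤ (λ a → ∑ℤ (λ j → ∑ℤ (λ b → F i j a b))))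
    ≡⟨ ∑-comm (λ i a → ∑ℤ (λ j → ∑ℤ (F i j a))) ⟩
  ∑ℤ (λ a → ∑ℤ (λ i → ∑ℤ (λ j → ∑ℤ (λ b → F i j a b))))
    ≡⟨ ∑-cong (λ a → ∑-cong (λ i → ∑-comm (λ j b → F i j a b))) ⟩
  ∑ℤ (λ a → ∑ℤ (λ i → ∑ℤ (λ b → ∑ℤ (λ j → F i j a b))))
    ≡⟨ ∑-cong (λ a → ∑-comm (λ i b → ∑ℤ (λ j → F i j a b))) ⟩
  ∑ℤ (λ a → ∑ℤ (λ b → ∑ℤ (λ i → ∑ℤ (λ j → F i j a b)))) ∎
  where open ≡-Reasoning

δ : ∀ {m} → Fin m → Vecℤ m
δ zero    zero    = + 1
δ zero    (suc _) = + 0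
δ (suc _) zero    = + 0
δ (suc k) (suc j) = δ k j

∑-δ : ∀ {m} (k : Fin m) (f : Fin m → ℤ) → ∑ℤ (λ j → δ k j ℤ.* f j) ≡ f k
∑-δ zero f = begin
  + 1 ℤ.* f zero ℤ.+ ∑ℤ (λ j → + 0 ℤ.* f (suc j))
    ≡⟨ cong₂ ℤ._+_ (ℤP.*-identityˡ (f zero)) (sym (*-distribˡ-∑ (+ 0) (λ j → f (suc j)))) ⟩
  f zero ℤ.+ + 0 ℤ.* ∑ℤ (λ j → f (suc j))
    ≡⟨ ℤP.+-identityʳ (f zero) ⟩
  f zero ∎
  where open ≡-Reasoning
∑-δ (suc k) f = trans (ℤP.+-identityˡ (∑ℤ (λ j → δ k j ℤ.* f (suc j)))) (∑-δ k (λ j → f (suc j)))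

B-δ : ∀ {m} (H : Gram m) a b → B H (δ a) (δ b) ≡ H a b
B-δ H a b = begin
  ∑ℤ (λ i → ∑ℤ (λ j → δ a i ℤ.* H i j ℤ.* δ b j))
    ≡⟨ ∑-cong (λ i → ∑-cong (λ j → ℤP.*-comm (δ a i ℤ.* H i j) (δ b j))) ⟩
  ∑ℤ (λ i → ∑ℤ (λ j → δ b j ℤ.* (δ a i ℤ.* H i j)))
    ≡⟨ ∑-cong (λ i → ∑-δ b (λ j → δ a i ℤ.* H i j)) ⟩
  ∑ℤ (λ i → δ a i ℤ.* H i b)
    ≡⟨ ∑-δ a (λ i → H i b) ⟩
  H a b ∎
  where open ≡-Reasoning

B-congᴳ : ∀ {n} {G G′ : Gram n} → (∀ i j → G i j ≡ G′ i j) → ∀ x y → B G x y ≡ B G′ x y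
B-congᴳ G≗G′ x y = ∑-cong (λ i → ∑-cong (λ j → cong (λ g → x i ℤ.* g ℤ.* y j) (G≗G′ i j)))

column : ∀ {n m} → Matℤ n m → Fin m → Vecℤ n
column σ a i = σ i a

columnGram : ∀ {n m} → Gram n → Matℤ n m → Gram m
columnGram G σ a b = B G (column σ a) (column σ b)

*-distrib-∑∑ : ∀ {n m} (f : Fin n → ℤ) g (h : Fin m → ℤ) →
  ∑ℤ f ℤ.* g ℤ.* ∑ℤ h ≡ ∑ℤ (λ a → ∑ℤ (λ b → f a ℤ.* g ℤ.* h b))
*-distrib-∑∑ f g h = trans (cong (ℤ._* ∑ℤ h) (*-distribʳ-∑ g f))
  (trans (*-distribʳ-∑ (∑ℤ h) (λ a → f a ℤ.* g)) (∑-cong (λ a → *-distribˡ-∑ (f a ℤ.* g) h)))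

B-apply : ∀ {n m} (G : Gram n) (σ : Matℤ n m) x y →
  B G (apply σ x) (apply σ y) ≡ B (columnGram G σ) x y
B-apply {n} G σ x y = begin
  B G (apply σ x) (apply σ y)
    ≡⟨ ∑-cong (λ i → ∑-cong (λ j → *-distrib-∑∑ (λ a → σ i a ℤ.* x a) (G i j) (λ b → σ j b ℤ.* y b))) ⟩
  ∑ℤ (λ i → ∑ℤ (λ j → ∑ℤ (λ a → ∑ℤ (λ b → σ i a ℤ.* x a ℤ.* G i j ℤ.* (σ j b ℤ.* y b)))))
    ≡⟨ ∑²-comm (λ i j a b → σ i a ℤ.* x a ℤ.* G i j ℤ.* (σ j b ℤ.* y b)) ⟩
  ∑ℤ (λ a → ∑ℤ (λ b → ∑ℤ (λ i → ∑ℤ (λ j → σ i a ℤ.* x a ℤ.* G i j ℤ.* (σ j b ℤ.* y b)))))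
    ≡⟨ ∑-cong (λ a → ∑-cong (λ b → ∑-cong (λ i → ∑-cong (λ j →
         regroup (σ i a) (x a) (G i j) (σ j b) (y b))))) ⟩
  ∑ℤ (λ a → ∑ℤ (λ b → ∑ℤ (λ i → ∑ℤ (λ j → x a ℤ.* (σ i a ℤ.* G i j ℤ.* σ j b) ℤ.* y b))))
    ≡⟨ ∑-cong (λ a → ∑-cong (λ b → factor (x a) (y b) (λ i j → σ i a ℤ.* G i j ℤ.* σ j b))) ⟩
  ∑ℤ (λ a → ∑ℤ (λ b → x a ℤ.* columnGram G σ a b ℤ.* y b)) ∎
  where
  open ≡-Reasoning
  regroup : ∀ p q r s t → p ℤ.* q ℤ.* r ℤ.* (s ℤ.* t) ≡ q ℤ.* (p ℤ.* r ℤ.* s) ℤ.* t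
  regroup = solve-∀
  factor : ∀ c d (K : Fin n → Fin n → ℤ) →
    ∑ℤ (λ i → ∑ℤ (λ j → c ℤ.* K i j ℤ.* d)) ≡ c ℤ.* ∑ℤ (λ i → ∑ℤ (K i)) ℤ.* d
  factor c d K = sym (begin
    c ℤ.* ∑ℤ (λ i → ∑ℤ (K i)) ℤ.* d
      ≡⟨ cong (ℤ._* d) (*-distribˡ-∑ c (λ i → ∑ℤ (K i))) ⟩
    ∑ℤ (λ i → c ℤ.* ∑ℤ (K i)) ℤ.* d
      ≡⟨ *-distribʳ-∑ d (λ i → c ℤ.* ∑ℤ (K i)) ⟩
    ∑ℤ (λ i → c ℤ.* ∑ℤ (K i) ℤ.* d)
      ≡⟨ ∑-cong (λ i → trans (cong (ℤ._* d) (*-distribˡ-∑ c (K i))) (*-distribʳ-∑ d (λ j → c ℤ.* K i j))) ⟩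
    ∑ℤ (λ i → ∑ℤ (λ j → c ℤ.* K i j ℤ.* d)) ∎)

columns⇒representation : ∀ {n m} {H : Gram m} {G : Gram n} {σ : Matℤ n m} →
  (∀ a b → columnGram G σ a b ≡ H a b) → IsRepresentation H G σ
columns⇒representation {G = G} {σ} columns x y = trans (B-apply G σ x y) (B-congᴳ columns x y)

representation⇒columns : ∀ {n m} {H : Gram m} {G : Gram n} {σ : Matℤ n m} →
  IsRepresentation H G σ → ∀ a b → columnGram G σ a b ≡ H a b
representation⇒columns {H = H} {G} {σ} rep a b = begin
  columnGram G σ a b                  ≡⟨ B-δ (columnGram G σ) a b ⟨
  B (columnGram G σ) (δ a) (δ b)      ≡⟨ B-apply G σ (δ a) (δ b) ⟨
  B G (apply σ (δ a)) (apply σ (δ b)) ≡⟨ rep (δ a) (δ b) ⟩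
  B H (δ a) (δ b)                     ≡⟨ B-δ H a b ⟩
  H a b                               ∎
  where open ≡-Reasoning

toℚᵘ-toℚ : ∀ z → ℚ.toℚᵘ (toℚ z) ℚᵘ.≃ ℚᵘ.mkℚᵘ z 0
toℚᵘ-toℚ z = ℚP.toℚᵘ-fromℚᵘ (ℚᵘ.mkℚᵘ z 0)

toℚ-+ : ∀ x y → toℚ (x ℤ.+ y) ≡ toℚ x ℚ.+ toℚ y
toℚ-+ x y = ℚP.toℚᵘ-injective (begin-equality
  ℚ.toℚᵘ (toℚ (x ℤ.+ y))                       ≃⟨ toℚᵘ-toℚ (x ℤ.+ y) ⟩
  ℚᵘ.mkℚᵘ (x ℤ.+ y) 0                          ≃⟨ ℚᵘ.*≡* (distrib x y) ⟩
  ℚᵘ.mkℚᵘ x 0 ℚᵘ.+ ℚᵘ.mkℚᵘ y 0                 ≃⟨ ℚᵘP.+-cong (toℚᵘ-toℚ x) (toℚᵘ-toℚ y) ⟨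
  ℚ.toℚᵘ (toℚ x) ℚᵘ.+ ℚ.toℚᵘ (toℚ y)           ≃⟨ ℚP.toℚᵘ-homo-+ (toℚ x) (toℚ y) ⟨
  ℚ.toℚᵘ (toℚ x ℚ.+ toℚ y)                     ∎)
  where
  open ℚᵘP.≤-Reasoning
  distrib : ∀ x y → (x ℤ.+ y) ℤ.* + 1 ≡ (x ℤ.* + 1 ℤ.+ y ℤ.* + 1) ℤ.* + 1
  distrib = solve-∀

toℚ-* : ∀ x y → toℚ (x ℤ.* y) ≡ toℚ x ℚ.* toℚ y
toℚ-* x y = ℚP.toℚᵘ-injective (begin-equality
  ℚ.toℚᵘ (toℚ (x ℤ.* y))                       ≃⟨ toℚᵘ-toℚ (x ℤ.* y) ⟩
  ℚᵘ.mkℚᵘ (x ℤ.* y) 0                          ≡⟨⟩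
  ℚᵘ.mkℚᵘ x 0 ℚᵘ.* ℚᵘ.mkℚᵘ y 0                 ≃⟨ ℚᵘP.*-cong (toℚᵘ-toℚ x) (toℚᵘ-toℚ y) ⟨
  ℚ.toℚᵘ (toℚ x) ℚᵘ.* ℚ.toℚᵘ (toℚ y)           ≃⟨ ℚP.toℚᵘ-homo-* (toℚ x) (toℚ y) ⟨
  ℚ.toℚᵘ (toℚ x ℚ.* toℚ y)                     ∎)
  where open ℚᵘP.≤-Reasoning

toℚ-injective : ∀ {x y} → toℚ x ≡ toℚ y → x ≡ y
toℚ-injective {x} {y} eq with ℚP.fromℚᵘ-injective {ℚᵘ.mkℚᵘ x 0} {ℚᵘ.mkℚᵘ y 0} eq
... | ℚᵘ.*≡* x*1≡y*1 = trans (sym (ℤP.*-identityʳ x)) (trans x*1≡y*1 (ℤP.*-identityʳ y))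

∑ℚ-cong : ∀ {n} {f g : Fin n → ℚ.ℚ} → (∀ i → f i ≡ g i) → ∑ℚ f ≡ ∑ℚ g
∑ℚ-cong {ℕ.zero} f≗g = refl
∑ℚ-cong {ℕ.suc n} f≗g = cong₂ ℚ._+_ (f≗g zero) (∑ℚ-cong (λ i → f≗g (suc i)))

toℚ-∑ : ∀ {n} (f : Fin n → ℤ) → toℚ (∑ℤ f) ≡ ∑ℚ (λ i → toℚ (f i))
toℚ-∑ {ℕ.zero} f = refl
toℚ-∑ {ℕ.suc n} f = trans (toℚ-+ (f zero) (∑ℤ (λ i → f (suc i))))
  (cong (ℚ._+_ (toℚ (f zero))) (toℚ-∑ (λ i → f (suc i))))

toℚ-B : ∀ {n} (G : Gram n) x y → toℚ (B G x y) ≡ Bℚ G (embed x) (embed y)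
toℚ-B G x y =
  trans (toℚ-∑ (λ i → ∑ℤ (λ j → x i ℤ.* G i j ℤ.* y j))) (∑ℚ-cong λ i →
  trans (toℚ-∑ (λ j → x i ℤ.* G i j ℤ.* y j)) (∑ℚ-cong λ j →
  trans (toℚ-* (x i ℤ.* G i j) (y j)) (cong (ℚ._* toℚ (y j)) (toℚ-* (x i) (G i j)))))

Bℚ-cong : ∀ {n} (G : Gram n) {x x′ y y′ : Vecℚ n} →
  (∀ i → x i ≡ x′ i) → (∀ i → y i ≡ y′ i) → Bℚ G x y ≡ Bℚ G x′ y′
Bℚ-cong G x≗x′ y≗y′ = ∑ℚ-cong (λ i → ∑ℚ-cong (λ j →
  cong₂ (λ p q → p ℚ.* toℚ (G i j) ℚ.* q) (x≗x′ i) (y≗y′ j)))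

-- A record rather than a Π-type, so that T, x and y can be inferred from it.
record MapsTo {n} (T : Matℚ n) (x y : Vecℤ n) : Set where
  constructor mapsTo
  field maps : ∀ i → act T (embed x) i ≡ embed y i

InO⇒B-invariant : ∀ {n} {G : Gram n} {T : Matℚ n} {x x′ y y′ : Vecℤ n} →
  InO G T → MapsTo T x x′ → MapsTo T y y′ → B G x′ y′ ≡ B G x y
InO⇒B-invariant {G = G} {T} {x} {x′} {y} {y′} T∈O (mapsTo Tx≡x′) (mapsTo Ty≡y′) =
  toℚ-injective (begin
    toℚ (B G x′ y′)                          ≡⟨ toℚ-B G x′ y′ ⟩
    Bℚ G (embed x′) (embed y′)               ≡⟨ Bℚ-cong G (λ i → sym (Tx≡x′ i)) (λ i → sym (Ty≡y′ i)) ⟩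
    Bℚ G (act T (embed x)) (act T (embed y)) ≡⟨ T∈O (embed x) (embed y) ⟩
    Bℚ G (embed x) (embed y)                 ≡⟨ toℚ-B G x y ⟨
    toℚ (B G x y)                            ∎)
  where open ≡-Reasoning

isometry∘representation : ∀ {n m} {H : Gram m} {G : Gram n} {σ σ′ : Matℤ n m} {T : Matℚ n} →
  IsRepresentation H G σ → InO G T → (∀ a → MapsTo T (column σ a) (column σ′ a)) →
  IsRepresentation H G σ′
isometry∘representation {H = H} {G} {σ} {σ′} rep T∈O Tσ≡σ′ =
  columns⇒representation {H = H} {G} {σ′} λ a b →
    trans (InO⇒B-invariant T∈O (Tσ≡σ′ a) (Tσ≡σ′ b)) (representation⇒columns {H = H} {G} {σ} rep a b)

≡-refl[mod] : ∀ x s → x ≡ x [mod s ]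
≡-refl[mod] x s = subst (λ t → s ℕD.∣ ℤ.∣ t ∣) (sym (ℤP.+-inverseʳ x)) (s ℕD.∣0)

good-coset⇒representation : ∀ {n s} {H : Gram 2} {G : Gram n} {σ₀ : Matℤ n 2} {w : Vecℤ n} →
  IsRepresentation H G σ₀ → IsGood G s (column σ₀ zero) w (column σ₀ (suc zero)) →
  Σ (Matℤ n 2) (λ σ → IsRepresentation H G σ × (∀ i → σ i zero ≡ w i))
good-coset⇒representation {n} {s} {H} {G} {σ₀} {w} rep (T , (T∈O , _ , Tv≡w) , T-integral) =
  σ , isometry∘representation {H = H} {G} {σ₀} {σ} rep T∈O Tσ₀≡σ , λ _ → refl
  where
  Tu∈L : InL (act T (embed (column σ₀ (suc zero))))
  Tu∈L = T-integral (column σ₀ (suc zero)) (λ i → ≡-refl[mod] (σ₀ i (suc zero)) s)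
  σ : Matℤ n 2
  σ i zero = w i
  σ i (suc zero) = proj₁ Tu∈L i
  Tσ₀≡σ : ∀ a → MapsTo T (column σ₀ a) (column σ a)
  Tσ₀≡σ zero = mapsTo Tv≡w
  Tσ₀≡σ (suc zero) = mapsTo λ i → sym (proj₂ Tu∈L i)

lemma2p3 : (A s : ℕ) → 0 ℕ.< A → 0 ℕ.< s → (α β : ℤ) → (b a : ℤ)
    → a ≡ α [mod s ] → b ≡ β [mod s ]
    → + 0 ℤ.< (+ A ℤ.* a ℤ.- b ℤ.* b)
    → (n : ℕ) (G : Gram n) → IsSymmetric G → IsPosDef G
    → (w : Vecℤ n) → Q G w ≡ + A
    → Prec G (+ A) α β s w
    → Represented (binGram (+ A) b a) G
    → Σ (Matℤ n 2) (λ σ → IsRepresentation (binGram (+ A) b a) G σ × (∀ i → σ i zero ≡ w i))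
lemma2p3 A s _ _ α β b a a≡α b≡β _ n G _ _ w _ L≺w (σ₀ , rep) =
  good-coset⇒representation {H = binGram (+ A) b a} {G} {σ₀} rep (proj₂ (proj₁ (L≺w v Qv≡A u) u∈Rv))
  where
  v u : Vecℤ n
  v = column σ₀ zero
  u = column σ₀ (suc zero)
  gram₀ : ∀ p q → columnGram G σ₀ p q ≡ binGram (+ A) b a p q
  gram₀ = representation⇒columns {σ = σ₀} rep
  Qv≡A : Q G v ≡ + A
  Qv≡A = gram₀ zero zero
  u∈Rv : InRv G α β s v u
  u∈Rv = subst (_≡ α [mod s ]) (sym (gram₀ (suc zero) (suc zero))) a≡α
       , subst (_≡ β [mod s ]) (sym (gram₀ (suc zero) zero)) b≡β
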